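{- Let $a,b$ be positive integers and write $a=tb+r$ with integers $t\ge 0$ and $r\ge 0$. Let $\{x_0,\dots,x_{b-1}\}$ be a sequence of nonnegative integers with sum $a$, and set $x'_j=x_j-t$. Then $\{x_0,\dots,x_{b-1}\}$ characterizes the regular configuration in $\mathrm{CONF}(a,b)$ if and only if $\{x'_0,\dots,x'_{b-1}\}$ characterizes the regular configuration in $\mathrm{CONF}(r,b)$.
   Context: For nonnegative $a$ and $b>0$, $\mathrm{CONF}(a,b)$ is the set of necklaces (circular arrangements up to rotation) of $a$ red and $b$ black beads. A sequence $\{x_0,\dots,x_{b-1}\}$ of nonnegative integers with sum $a$ characterizes the necklace obtained by placing $b$ black beads $B_0,\dots,B_{b-1}$ around a circle and inserting $x_i$ red beads between $B_i$ and $B_{i+1}$ (indices mod $b$). Sequences that are cyclic shifts of each other characterize the same necklace. The necklace is regular if $\frac{a}{b}k-1<x_i+\dots+x_{i+k-1}<\frac{a}{b}k+1$ for all $0\le i\le b-1$ and $1\le k\le 1+\lfloor b/2\rfloor$ (indices mod $b$). There is a unique regular configuration in each $\mathrm{CONF}(a,b)$. -}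

module Defs where

open import Data.Nat as ℕ using (ℕ; zero; suc; NonZero)
open import Data.Nat.DivMod using (_%_; _/_; m%n<n)
open import Data.Fin using (Fin; fromℕ<)
import Data.Fin as F
open import Data.Integer as Z using (ℤ; +_; _-_; _*_; _<_; _≤_)
open import Data.Product using (_×_)
open import Relation.Binary.PropositionalEquality using (_≡_)

sumFin : ∀ {b} → (Fin b → ℤ) → ℤ
sumFin {zero}  x = + 0
sumFin {suc b} x = x F.zero Z.+ sumFin (λ j → x (F.suc j))

idx : (b : ℕ) .{{_ : NonZero b}} → ℕ → Fin b
idx b n = fromℕ< (m%n<n n b)

windowSum : (b : ℕ) .{{_ : NonZero b}} → (Fin b → ℤ) → ℕ → ℕ → ℤ
windowSum b x i zero    = + 0
windowSum b x i (suc k) = x (idx b i) Z.+ windowSum b x (suc i) k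

-- Regularity: (a/b)k - 1 < x_i+...+x_{i+k-1} < (a/b)k + 1 for all 0 ≤ i ≤ b-1
-- and 1 ≤ k ≤ 1 + ⌊b/2⌋; written after multiplying through by b > 0.
IsRegular : (a : ℤ) (b : ℕ) .{{_ : NonZero b}} → (Fin b → ℤ) → Set
IsRegular a b x =
  ∀ (i : ℕ) (k : ℕ) → i ℕ.< b → 1 ℕ.≤ k → k ℕ.≤ 1 ℕ.+ (b / 2) →
    (a * + k - + b < + b * windowSum b x i k) ×
    (+ b * windowSum b x i k < a * + k + + b)
  where open Z using (_+_)

CharacterizesRegular : (a : ℤ) (b : ℕ) .{{_ : NonZero b}} → (Fin b → ℤ) → Set
CharacterizesRegular a b x =
  (∀ j → + 0 ≤ x j) × (sumFin x ≡ a) × IsRegular a b x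

module Submission where

-- Subtracting a constant c from every gap x_j of a necklace
-- turns CONF(a,b) into CONF(a - c·b, b) and preserves regularity: every
-- window sum of length k drops by c·k while the bound (a/b)k drops by the
-- same amount, so both regularity inequalities (multiplied by b) are merely
-- shifted by b·c·k.  The only thing to check beyond this bookkeeping is that
-- the shifted gaps stay nonnegative; this follows from the k = 1 instance of
-- regularity, a/b - 1 < x_j, as soon as c·b ≤ a.

open import Defs
open import Data.Nat using (ℕ; NonZero; _*_; _+_; _<_)
open import Data.Fin using (Fin)
open import Data.Integer using (+_; _-_)
open import Function.Bundles using (_⇔_)
open import Relation.Binary.PropositionalEquality using (_≡_)

import Data.Nat as ℕ
import Data.Nat.Properties as ℕP
import Data.Integer as ℤ
import Data.Integer.Properties as ℤP
import Data.Fin as F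
import Data.Fin.Properties as FP
open import Data.Integer using (ℤ)
open import Data.Nat.DivMod using (m%n<n; m<n⇒m%n≡m)
open import Data.Product using (_×_; _,_; proj₁)
open import Data.Product.Function.NonDependent.Propositional using (_×-⇔_)
open import Function.Bundles using (mk⇔; Equivalence)
open import Relation.Binary.PropositionalEquality
  using (refl; sym; trans; cong; subst; subst₂; module ≡-Reasoning)
open import Data.Integer.Tactic.RingSolver using (solve-∀)

sumFin-shift : ∀ {b} (x : Fin b → ℤ) (c : ℤ) →
  sumFin (λ j → x j - c) ≡ sumFin x - c ℤ.* + b
sumFin-shift {ℕ.zero} x c = emptySum c
  where
  emptySum : ∀ c → + 0 ≡ + 0 - c ℤ.* + 0
  emptySum = solve-∀
sumFin-shift {ℕ.suc b} x c = begin
  (x F.zero - c) ℤ.+ sumFin (λ j → x (F.suc j) - c)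
    ≡⟨ cong (ℤ._+_ (x F.zero - c)) (sumFin-shift (λ j → x (F.suc j)) c) ⟩
  (x F.zero - c) ℤ.+ (sumFin (λ j → x (F.suc j)) - c ℤ.* + b)
    ≡⟨ regroup (x F.zero) (sumFin (λ j → x (F.suc j))) c (+ b) ⟩
  (x F.zero ℤ.+ sumFin (λ j → x (F.suc j))) - c ℤ.* + ℕ.suc b ∎
  where
  open ≡-Reasoning
  regroup : ∀ y s c n → (y - c) ℤ.+ (s - c ℤ.* n) ≡ (y ℤ.+ s) - c ℤ.* (+ 1 ℤ.+ n)
  regroup = solve-∀

windowSum-shift : ∀ b .{{_ : NonZero b}} (x : Fin b → ℤ) (c : ℤ) (i k : ℕ) →
  windowSum b (λ j → x j - c) i k ≡ windowSum b x i k - c ℤ.* + k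
windowSum-shift b x c i ℕ.zero = emptyWindow c
  where
  emptyWindow : ∀ c → + 0 ≡ + 0 - c ℤ.* + 0
  emptyWindow = solve-∀
windowSum-shift b x c i (ℕ.suc k) = begin
  (x (idx b i) - c) ℤ.+ windowSum b (λ j → x j - c) (ℕ.suc i) k
    ≡⟨ cong (ℤ._+_ (x (idx b i) - c)) (windowSum-shift b x c (ℕ.suc i) k) ⟩
  (x (idx b i) - c) ℤ.+ (windowSum b x (ℕ.suc i) k - c ℤ.* + k)
    ≡⟨ regroup (x (idx b i)) (windowSum b x (ℕ.suc i) k) c (+ k) ⟩
  (x (idx b i) ℤ.+ windowSum b x (ℕ.suc i) k) - c ℤ.* + ℕ.suc k ∎
  where
  open ≡-Reasoning
  regroup : ∀ y s c n → (y - c) ℤ.+ (s - c ℤ.* n) ≡ (y ℤ.+ s) - c ℤ.* (+ 1 ℤ.+ n)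
  regroup = solve-∀

<-shift : ∀ (d : ℤ) {u v U V : ℤ} → U ≡ u - d → V ≡ v - d → (U ℤ.< V) ⇔ (u ℤ.< v)
<-shift d {u} {v} refl refl = mk⇔
  (λ h → subst₂ ℤ._<_ (cancel u d) (cancel v d) (ℤP.+-monoˡ-< d h))
  (ℤP.+-monoˡ-< (ℤ.- d))
  where
  cancel : ∀ w d → (w - d) ℤ.+ d ≡ w
  cancel = solve-∀

-- Regularity of the shifted necklace in CONF(a - c·b, b) is equivalent to
-- regularity of the original one in CONF(a, b): both bounds of each window
-- inequality move by b·c·k.
isRegular-shift : ∀ (a c : ℤ) (b : ℕ) .{{_ : NonZero b}} (x : Fin b → ℤ) →
  IsRegular (a - c ℤ.* + b) b (λ j → x j - c) ⇔ IsRegular a b x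
isRegular-shift a c b x = mk⇔
  (λ R i k i<b 1≤k k≤ → Equivalence.to   (window i k) (R i k i<b 1≤k k≤))
  (λ R i k i<b 1≤k k≤ → Equivalence.from (window i k) (R i k i<b 1≤k k≤))
  where
  W W' : ℕ → ℕ → ℤ
  W  = windowSum b x
  W' = windowSum b (λ j → x j - c)

  drop : ℕ → ℤ
  drop k = + b ℤ.* (c ℤ.* + k)

  scaledWindow : ∀ i k → + b ℤ.* W' i k ≡ + b ℤ.* W i k - drop k
  scaledWindow i k = trans (cong (ℤ._*_ (+ b)) (windowSum-shift b x c i k))
                           (distrib (+ b) (W i k) (c ℤ.* + k))
    where
    distrib : ∀ n w e → n ℤ.* (w - e) ≡ n ℤ.* w - n ℤ.* e
    distrib = solve-∀

  lowerBound : ∀ k → (a - c ℤ.* + b) ℤ.* + k - + b ≡ (a ℤ.* + k - + b) - drop k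
  lowerBound k = rearrange a c (+ b) (+ k)
    where
    rearrange : ∀ a c n m → (a - c ℤ.* n) ℤ.* m - n ≡ (a ℤ.* m - n) - n ℤ.* (c ℤ.* m)
    rearrange = solve-∀

  upperBound : ∀ k → (a - c ℤ.* + b) ℤ.* + k ℤ.+ + b ≡ (a ℤ.* + k ℤ.+ + b) - drop k
  upperBound k = rearrange a c (+ b) (+ k)
    where
    rearrange : ∀ a c n m → (a - c ℤ.* n) ℤ.* m ℤ.+ n ≡ (a ℤ.* m ℤ.+ n) - n ℤ.* (c ℤ.* m)
    rearrange = solve-∀

  window : ∀ i k →
    ((a - c ℤ.* + b) ℤ.* + k - + b ℤ.< + b ℤ.* W' i k
      × + b ℤ.* W' i k ℤ.< (a - c ℤ.* + b) ℤ.* + k ℤ.+ + b)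
    ⇔ (a ℤ.* + k - + b ℤ.< + b ℤ.* W i k × + b ℤ.* W i k ℤ.< a ℤ.* + k ℤ.+ + b)
  window i k = <-shift (drop k) (lowerBound k) (scaledWindow i k)
           ×-⇔ <-shift (drop k) (scaledWindow i k) (upperBound k)

-- The window of length 1 starting at position toℕ j is the single gap x_j.
idx-toℕ : ∀ b .{{_ : NonZero b}} (j : Fin b) → idx b (F.toℕ j) ≡ j
idx-toℕ b j = FP.toℕ-injective
  (trans (FP.toℕ-fromℕ< (m%n<n (F.toℕ j) b)) (m<n⇒m%n≡m (FP.toℕ<n j)))

-- In a regular necklace of CONF(a, b) every gap exceeds a/b - 1; hence every
-- gap is at least c whenever c·b ≤ a.
regular-gap-lowerBound : ∀ (a c : ℤ) (b : ℕ) .{{_ : NonZero b}} (x : Fin b → ℤ) →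
  IsRegular a b x → c ℤ.* + b ℤ.≤ a → ∀ j → c ℤ.≤ x j
regular-gap-lowerBound a c b x R cb≤a j =
  subst (ℤ._≤ x j) (predSuc c) (ℤP.i<j⇒suc[i]≤j (ℤP.*-cancelˡ-<-nonNeg (+ b) scaled))
  where
  open ℤP.≤-Reasoning

  singleGap : a ℤ.* + 1 - + b ℤ.< + b ℤ.* (x j ℤ.+ + 0)
  singleGap = subst (λ g → a ℤ.* + 1 - + b ℤ.< + b ℤ.* (x g ℤ.+ + 0)) (idx-toℕ b j)
    (proj₁ (R (F.toℕ j) 1 (FP.toℕ<n j) ℕP.≤-refl (ℕP.m≤m+n 1 _)))

  scaled : + b ℤ.* (c - + 1) ℤ.< + b ℤ.* x j
  scaled = begin-strict
    + b ℤ.* (c - + 1)     ≡⟨ factor (+ b) c ⟩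
    c ℤ.* + b - + b       ≤⟨ ℤP.+-monoˡ-≤ (ℤ.- + b) cb≤a ⟩
    a - + b               ≡⟨ unit a (+ b) ⟩
    a ℤ.* + 1 - + b       <⟨ singleGap ⟩
    + b ℤ.* (x j ℤ.+ + 0) ≡⟨ cong (ℤ._*_ (+ b)) (ℤP.+-identityʳ (x j)) ⟩
    + b ℤ.* x j           ∎
    where
    factor : ∀ n c → n ℤ.* (c - + 1) ≡ c ℤ.* n - n
    factor = solve-∀
    unit : ∀ a n → a - n ≡ a ℤ.* + 1 - n
    unit = solve-∀

  predSuc : ∀ c → + 1 ℤ.+ (c - + 1) ≡ c
  predSuc = solve-∀

characterizesRegular-shift : ∀ (a c : ℤ) (b : ℕ) .{{_ : NonZero b}} (x : Fin b → ℤ) →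
  + 0 ℤ.≤ c → c ℤ.* + b ℤ.≤ a →
  CharacterizesRegular a b x ⇔ CharacterizesRegular (a - c ℤ.* + b) b (λ j → x j - c)
characterizesRegular-shift a c b x 0≤c cb≤a = mk⇔
  (λ { (_ , sum≡a , R) →
       (λ j → ℤP.i≤j⇒0≤j-i (regular-gap-lowerBound a c b x R cb≤a j))
     , trans (sumFin-shift x c) (cong (_- c ℤ.* + b) sum≡a)
     , Equivalence.from (isRegular-shift a c b x) R })
  (λ { (0≤x-c , sum≡a-cb , R) →
       (λ j → subst (+ 0 ℤ.≤_) (unshift (x j) c) (ℤP.+-mono-≤ (0≤x-c j) 0≤c))
     , shiftedSum sum≡a-cb
     , Equivalence.to (isRegular-shift a c b x) R })
  where
  unshift : ∀ y c → (y - c) ℤ.+ c ≡ y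
  unshift = solve-∀

  shiftedSum : sumFin (λ j → x j - c) ≡ a - c ℤ.* + b → sumFin x ≡ a
  shiftedSum eq = begin
    sumFin x                                   ≡⟨ sym (unshift (sumFin x) (c ℤ.* + b)) ⟩
    (sumFin x - c ℤ.* + b) ℤ.+ c ℤ.* + b       ≡⟨ cong (ℤ._+ c ℤ.* + b) (trans (sym (sumFin-shift x c)) eq) ⟩
    (a - c ℤ.* + b) ℤ.+ c ℤ.* + b              ≡⟨ unshift a (c ℤ.* + b) ⟩
    a                                          ∎
    where open ≡-Reasoning

proposition4 : (a b t r : ℕ) .{{_ : NonZero b}} → 0 < a → a ≡ t * b + r →
    (x : Fin b → ℕ) → sumFin (λ j → + x j) ≡ + a →
    CharacterizesRegular (+ a) b (λ j → + x j)
      ⇔ CharacterizesRegular (+ r) b (λ j → + x j - + t)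
proposition4 a b t r _ a≡tb+r x _ =
  subst (λ s → CharacterizesRegular (+ a) b (λ j → + x j) ⇔ CharacterizesRegular s b (λ j → + x j - + t))
        a-tb≡r
        (characterizesRegular-shift (+ a) (+ t) b (λ j → + x j) (ℤ.+≤+ ℕ.z≤n) tb≤a)
  where
  a≡tb+r' : + a ≡ + t ℤ.* + b ℤ.+ + r
  a≡tb+r' = trans (cong +_ a≡tb+r)
                  (trans (ℤP.pos-+ (t * b) r) (cong (ℤ._+ + r) (ℤP.pos-* t b)))

  tb≤a : + t ℤ.* + b ℤ.≤ + a
  tb≤a = subst (+ t ℤ.* + b ℤ.≤_) (sym a≡tb+r') (ℤP.i≤i+j (+ t ℤ.* + b) (+ r))

  a-tb≡r : + a - + t ℤ.* + b ≡ + r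
  a-tb≡r = trans (cong (_- + t ℤ.* + b) a≡tb+r') (cancel (+ t ℤ.* + b) (+ r))
    where
    cancel : ∀ m n → (m ℤ.+ n) - m ≡ n
    cancel = solve-∀
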